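{- Let $n\ge1$ and $k\ge0$. The Zeta polynomial of the poset $\mathscr{P}^{\mathbb{B}}_{n,k}$ is $\binom{n(u-1)+k}{k}$ (as a polynomial in $u$).
   Context: $\mathscr{P}^{\mathbb{B}}_{n,k}$ is the set of $n$-tuples $(x_1,\dots,x_n)$ of nonnegative integers with $\sum_ix_i\le k$, ordered term-wise. The Zeta polynomial of a finite poset $P$ is the polynomial $Z(u)$ such that for every integer $q\ge2$, $Z(q)$ is the number of multichains $e_1\le\cdots\le e_{q-1}$ in $P$. -}

module Defs where

open import Data.Nat using (ℕ; zero; suc; _≤_)
open import Data.Product using (Σ; proj₁)
open import Data.Vec using (Vec; []; _∷_; sum)
open import Data.Vec.Relation.Binary.Pointwise.Inductive using (Pointwise)

PB : ℕ → ℕ → Set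
PB n k = Σ (Vec ℕ n) (λ x → sum x ≤ k)

_≼_ : ∀ {n k} → PB n k → PB n k → Set
x ≼ y = Pointwise _≤_ (proj₁ x) (proj₁ y)

data IsMultichain {n k : ℕ} : ∀ {m} → Vec (PB n k) m → Set where
  nil  : IsMultichain []
  one  : ∀ x → IsMultichain (x ∷ [])
  cons : ∀ {m} x y (es : Vec (PB n k) m) →
         x ≼ y → IsMultichain (y ∷ es) → IsMultichain (x ∷ y ∷ es)

Multichain : ℕ → ℕ → ℕ → Set
Multichain n k m = Σ (Vec (PB n k) m) IsMultichain

{-# OPTIONS --safe #-}
-- A multichain e₁ ≼ e₂ ≼ ⋯ ≼ eₘ in P_{n,k} is determined by e₁ together with the multichain
-- e₂ − e₁ ≼ ⋯ ≼ eₘ − e₁, which lives in P_{n,k−|e₁|}.  Unfolding this recursion, a multichain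
-- of length m amounts to the concatenation of e₁ and its successive increments: an
-- (m·n)-tuple of naturals whose coordinate sum |eₘ| is at most k.  So the multichains of
-- length q − 1 are in bijection with P_{n(q−1),k}, and |P_{N,k}| = C(N + k, k) by Pascal's
-- rule, splitting on whether the first coordinate is 0 or can be decreased by one.
module Submission where

open import Defs
open import Data.Nat using (ℕ; zero; suc; _≤_; _*_; _+_; _∸_; z≤n; s≤s)
open import Data.Nat.Properties
open import Algebra.Properties.CommutativeSemigroup +-commutativeSemigroup using (interchange)
open import Data.Nat.Combinatorics using (_C_; nCn≡1; nCk+nC[k+1]≡[n+1]C[k+1])
open import Data.Fin using (Fin)
open import Data.Fin.Properties using (+↔⊎; 1↔⊤)
open import Data.Product using (Σ; _,_; proj₁; proj₂)
import Data.Product.Function.Dependent.Propositional as Σ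
open import Data.Sum using (_⊎_; inj₁; inj₂)
open import Data.Sum.Function.Propositional using (_⊎-↔_)
open import Data.Unit using (⊤; tt)
open import Data.Vec using (Vec; []; _∷_; sum; zipWith; _++_; map; take; drop)
open import Data.Vec.Properties using (sum-++; take++drop≡id; ++-injective)
open import Data.Vec.Relation.Binary.Pointwise.Inductive as Pointwise
  using (Pointwise; []; _∷_)
open import Function.Bundles using (_↔_; mk↔ₛ′)
open import Function.Related.Propositional using (module EquationalReasoning)
open import Relation.Binary.Definitions using (Irrelevant)
open import Relation.Binary.PropositionalEquality

∣_∣ : ∀ {n k} → PB n k → ℕ
∣ x ∣ = sum (proj₁ x)

n≤o∸m⇒m+n≤o : ∀ {m n o} → m ≤ o → n ≤ o ∸ m → m + n ≤ o
n≤o∸m⇒m+n≤o {m} {n} {o} m≤o n≤o∸m = subst (_≤ o) (+-comm n m) (m≤o∸n⇒m+n≤o n m≤o n≤o∸m)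

m+n≤o⇒n≤o∸m : ∀ m {n o} → m + n ≤ o → n ≤ o ∸ m
m+n≤o⇒n≤o∸m m {n} {o} m+n≤o = m+n≤o⇒m≤o∸n n (subst (_≤ o) (+-comm m n) m+n≤o)

Pointwise-irrelevant : ∀ {A : Set} {R : A → A → Set} → Irrelevant R →
                       ∀ {n} {xs ys : Vec A n} (p q : Pointwise R xs ys) → p ≡ q
Pointwise-irrelevant R-irr []       []       = refl
Pointwise-irrelevant R-irr (p ∷ ps) (q ∷ qs) =
  cong₂ _∷_ (R-irr p q) (Pointwise-irrelevant R-irr ps qs)

IsMultichain-irrelevant : ∀ {n k m} {es : Vec (PB n k) m} (p q : IsMultichain es) → p ≡ q
IsMultichain-irrelevant nil               nil                  = refl
IsMultichain-irrelevant (one x)           (one .x)             = refl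
IsMultichain-irrelevant (cons x y es p c) (cons .x .y .es q d) =
  cong₂ (cons x y es) (Pointwise-irrelevant ≤-irrelevant p q) (IsMultichain-irrelevant c d)

PB-ext : ∀ {n k} {x y : PB n k} → proj₁ x ≡ proj₁ y → x ≡ y
PB-ext {x = v , p} {.v , q} refl = cong (v ,_) (≤-irrelevant p q)

Multichain-ext : ∀ {n k m} {a b : Multichain n k m} → proj₁ a ≡ proj₁ b → a ≡ b
Multichain-ext {a = es , p} {.es , q} refl = cong (es ,_) (IsMultichain-irrelevant p q)

infixl 6 _⊕_ _⊖_

_⊕_ _⊖_ : ∀ {n} → Vec ℕ n → Vec ℕ n → Vec ℕ n
_⊕_ = zipWith _+_
_⊖_ = zipWith _∸_

sum-⊕ : ∀ {n} (x y : Vec ℕ n) → sum (x ⊕ y) ≡ sum x + sum y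
sum-⊕ []      []      = refl
sum-⊕ (a ∷ x) (b ∷ y) = trans (cong (a + b +_) (sum-⊕ x y)) (interchange a b (sum x) (sum y))

x⊕y⊖x≡y : ∀ {n} (x y : Vec ℕ n) → x ⊕ y ⊖ x ≡ y
x⊕y⊖x≡y []      []      = refl
x⊕y⊖x≡y (a ∷ x) (b ∷ y) = cong₂ _∷_ (m+n∸m≡n a b) (x⊕y⊖x≡y x y)

x⊕[y⊖x]≡y : ∀ {n} {x y : Vec ℕ n} → Pointwise _≤_ x y → x ⊕ (y ⊖ x) ≡ y
x⊕[y⊖x]≡y []         = refl
x⊕[y⊖x]≡y (a≤b ∷ x≤y) = cong₂ _∷_ (m+[n∸m]≡n a≤b) (x⊕[y⊖x]≡y x≤y)

x≤x⊕y : ∀ {n} (x y : Vec ℕ n) → Pointwise _≤_ x (x ⊕ y)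
x≤x⊕y []      []      = []
x≤x⊕y (a ∷ x) (b ∷ y) = m≤m+n a b ∷ x≤x⊕y x y

⊕-monoʳ-≤ : ∀ {n} (x : Vec ℕ n) {y z : Vec ℕ n} →
            Pointwise _≤_ y z → Pointwise _≤_ (x ⊕ y) (x ⊕ z)
⊕-monoʳ-≤ x = Pointwise.zipWith-cong +-mono-≤ (Pointwise.refl ≤-refl)

⊖-monoˡ-≤ : ∀ {n} (x : Vec ℕ n) {y z : Vec ℕ n} →
            Pointwise _≤_ y z → Pointwise _≤_ (y ⊖ x) (z ⊖ x)
⊖-monoˡ-≤ []      []          = []
⊖-monoˡ-≤ (a ∷ x) (b≤c ∷ y≤z) = ∸-monoˡ-≤ a b≤c ∷ ⊖-monoˡ-≤ x y≤z

sum-⊖ : ∀ {n} {x y : Vec ℕ n} → Pointwise _≤_ x y → sum (y ⊖ x) ≡ sum y ∸ sum x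
sum-⊖ {x = x} {y} x≤y = begin
  sum (y ⊖ x)                  ≡⟨ m+n∸m≡n (sum x) (sum (y ⊖ x)) ⟨
  sum x + sum (y ⊖ x) ∸ sum x  ≡⟨ cong (_∸ sum x) (sum-⊕ x (y ⊖ x)) ⟨
  sum (x ⊕ (y ⊖ x)) ∸ sum x    ≡⟨ cong (λ z → sum z ∸ sum x) (x⊕[y⊖x]≡y x≤y) ⟩
  sum y ∸ sum x                ∎
  where open ≡-Reasoning

IsMultichain-lowerHead : ∀ {n k m} {x y : PB n k} {es : Vec (PB n k) m} →
                         x ≼ y → IsMultichain (y ∷ es) → IsMultichain (x ∷ es)
IsMultichain-lowerHead {x = x} _   (one _)              = one x
IsMultichain-lowerHead {x = x} x≼y (cons _ z es y≼z c) =
  cons x z es (Pointwise.trans ≤-trans x≼y y≼z) c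

map-IsMultichain : ∀ {n k n′ k′ m} (f : PB n k → PB n′ k′) → (∀ x y → x ≼ y → f x ≼ f y) →
                   {es : Vec (PB n k) m} → IsMultichain es → IsMultichain (map f es)
map-IsMultichain f f-mono nil                = nil
map-IsMultichain f f-mono (one x)            = one (f x)
map-IsMultichain f f-mono (cons x y es x≼y c) =
  cons (f x) (f y) (map f es) (f-mono x y x≼y) (map-IsMultichain f f-mono c)

module _ {n k : ℕ} where

  translate : (x : PB n k) → PB n (k ∸ ∣ x ∣) → PB n k
  translate (x , x≤k) (d , d≤k∸x) =
    x ⊕ d , subst (_≤ k) (sym (sum-⊕ x d)) (n≤o∸m⇒m+n≤o x≤k d≤k∸x)

  untranslate : (x y : PB n k) → x ≼ y → PB n (k ∸ ∣ x ∣)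
  untranslate (x , _) (y , y≤k) x≼y =
    y ⊖ x , subst (_≤ k ∸ sum x) (sym (sum-⊖ x≼y)) (∸-monoˡ-≤ (sum x) y≤k)

  ≼-translate : (x : PB n k) (d : PB n (k ∸ ∣ x ∣)) → x ≼ translate x d
  ≼-translate (x , _) (d , _) = x≤x⊕y x d

  translate-mono : (x : PB n k) (d e : PB n (k ∸ ∣ x ∣)) → d ≼ e → translate x d ≼ translate x e
  translate-mono (x , _) _ _ = ⊕-monoʳ-≤ x

  untranslate-mono : (x y z : PB n k) (x≼y : x ≼ y) (x≼z : x ≼ z) →
                     y ≼ z → untranslate x y x≼y ≼ untranslate x z x≼z
  untranslate-mono (x , _) _ _ _ _ = ⊖-monoˡ-≤ x

  untranslate-translate : (x : PB n k) (d : PB n (k ∸ ∣ x ∣)) (x≼x+d : x ≼ translate x d) →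
                          untranslate x (translate x d) x≼x+d ≡ d
  untranslate-translate (x , _) (d , _) _ = PB-ext (x⊕y⊖x≡y x d)

  translate-untranslate : (x y : PB n k) (x≼y : x ≼ y) → translate x (untranslate x y x≼y) ≡ y
  translate-untranslate _ _ x≼y = PB-ext (x⊕[y⊖x]≡y x≼y)

  translate-IsMultichain : ∀ {m} (x : PB n k) {ds : Vec (PB n (k ∸ ∣ x ∣)) m} →
                           IsMultichain ds → IsMultichain (x ∷ map (translate x) ds)
  translate-IsMultichain x {[]}    _ = one x
  translate-IsMultichain x {d ∷ _} c =
    cons x _ _ (≼-translate x d) (map-IsMultichain (translate x) (translate-mono x) c)

  untranslateAll : ∀ {m} (x : PB n k) (es : Vec (PB n k) m) →
                   IsMultichain (x ∷ es) → Vec (PB n (k ∸ ∣ x ∣)) m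
  untranslateAll x []       _                  = []
  untranslateAll x (y ∷ es) (cons _ _ _ x≼y c) =
    untranslate x y x≼y ∷ untranslateAll x es (IsMultichain-lowerHead x≼y c)

  untranslateAll-IsMultichain : ∀ {m} (x : PB n k) (es : Vec (PB n k) m) (c : IsMultichain (x ∷ es)) →
                                IsMultichain (untranslateAll x es c)
  untranslateAll-IsMultichain x []           _                = nil
  untranslateAll-IsMultichain x (y ∷ [])     (cons _ _ _ _ _) = one _
  untranslateAll-IsMultichain x (y ∷ z ∷ es) (cons _ _ _ x≼y c@(cons _ _ _ y≼z _)) =
    cons _ _ _ (untranslate-mono x y z x≼y (Pointwise.trans ≤-trans x≼y y≼z) y≼z)
      (untranslateAll-IsMultichain x (z ∷ es) (IsMultichain-lowerHead x≼y c))

  untranslateAll-translate : ∀ {m} (x : PB n k) (ds : Vec (PB n (k ∸ ∣ x ∣)) m)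
                             (c : IsMultichain (x ∷ map (translate x) ds)) →
                             untranslateAll x (map (translate x) ds) c ≡ ds
  untranslateAll-translate x []       _                     = refl
  untranslateAll-translate x (d ∷ ds) (cons _ _ _ x≼x+d c) =
    cong₂ _∷_ (untranslate-translate x d x≼x+d)
              (untranslateAll-translate x ds (IsMultichain-lowerHead x≼x+d c))

  translate-untranslateAll : ∀ {m} (x : PB n k) (es : Vec (PB n k) m) (c : IsMultichain (x ∷ es)) →
                             map (translate x) (untranslateAll x es c) ≡ es
  translate-untranslateAll x []       _                   = refl
  translate-untranslateAll x (y ∷ es) (cons _ _ _ x≼y c) =
    cong₂ _∷_ (translate-untranslate x y x≼y)
              (translate-untranslateAll x es (IsMultichain-lowerHead x≼y c))

  Multichain-suc↔ : ∀ m → Multichain n k (suc m) ↔ Σ (PB n k) (λ x → Multichain n (k ∸ ∣ x ∣) m)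
  Multichain-suc↔ m = mk↔ₛ′ split join split∘join join∘split
    where
    split : Multichain n k (suc m) → Σ (PB n k) (λ x → Multichain n (k ∸ ∣ x ∣) m)
    split (x ∷ es , c) = x , untranslateAll x es c , untranslateAll-IsMultichain x es c

    join : Σ (PB n k) (λ x → Multichain n (k ∸ ∣ x ∣) m) → Multichain n k (suc m)
    join (x , ds , c) = x ∷ map (translate x) ds , translate-IsMultichain x c

    split∘join : ∀ xds → split (join xds) ≡ xds
    split∘join (x , ds , c) =
      cong (x ,_) (Multichain-ext (untranslateAll-translate x ds (translate-IsMultichain x c)))

    join∘split : ∀ es → join (split es) ≡ es
    join∘split (x ∷ es , c) = Multichain-ext (cong (x ∷_) (translate-untranslateAll x es c))

take-++ : ∀ {A : Set} {m n} (x : Vec A m) (y : Vec A n) → take m (x ++ y) ≡ x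
take-++ {m = m} x y = proj₁ (++-injective (take m (x ++ y)) x (take++drop≡id m (x ++ y)))

drop-++ : ∀ {A : Set} {m n} (x : Vec A m) (y : Vec A n) → drop m (x ++ y) ≡ y
drop-++ {m = m} x y = proj₂ (++-injective (take m (x ++ y)) x (take++drop≡id m (x ++ y)))

PB-+↔ : ∀ n L k → PB (n + L) k ↔ Σ (PB n k) (λ x → PB L (k ∸ ∣ x ∣))
PB-+↔ n L k = mk↔ₛ′ split join split∘join join∘split
  where
  pair-ext : {a b : Σ (PB n k) (λ x → PB L (k ∸ ∣ x ∣))} →
             proj₁ (proj₁ a) ≡ proj₁ (proj₁ b) → proj₁ (proj₂ a) ≡ proj₁ (proj₂ b) → a ≡ b
  pair-ext {(x , p) , (y , q)} {(.x , p′) , (.y , q′)} refl refl =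
    cong₂ (λ p q → (x , p) , (y , q)) (≤-irrelevant p p′) (≤-irrelevant q q′)

  split : PB (n + L) k → Σ (PB n k) (λ x → PB L (k ∸ ∣ x ∣))
  split (v , v≤k) = (take n v , m+n≤o⇒m≤o _ bound) , (drop n v , m+n≤o⇒n≤o∸m _ bound)
    where
    bound : sum (take n v) + sum (drop n v) ≤ k
    bound = subst (_≤ k) (trans (cong sum (sym (take++drop≡id n v))) (sum-++ (take n v))) v≤k

  join : Σ (PB n k) (λ x → PB L (k ∸ ∣ x ∣)) → PB (n + L) k
  join ((x , x≤k) , (y , y≤k∸x)) = x ++ y , subst (_≤ k) (sym (sum-++ x)) (n≤o∸m⇒m+n≤o x≤k y≤k∸x)

  split∘join : ∀ xy → split (join xy) ≡ xy
  split∘join ((x , _) , (y , _)) = pair-ext (take-++ x y) (drop-++ x y)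

  join∘split : ∀ v → join (split v) ≡ v
  join∘split (v , _) = PB-ext (take++drop≡id n v)

Multichain↔PB : ∀ m n k → Multichain n k m ↔ PB (m * n) k
Multichain↔PB zero n k =
  mk↔ₛ′ (λ _ → [] , z≤n) (λ _ → [] , nil) (λ { ([] , z≤n) → refl }) (λ { ([] , nil) → refl })
Multichain↔PB (suc m) n k = begin
  Multichain n k (suc m)                         ↔⟨ Multichain-suc↔ m ⟩
  Σ (PB n k) (λ x → Multichain n (k ∸ ∣ x ∣) m)  ↔⟨ Σ.congˡ (λ {x} → Multichain↔PB m n (k ∸ ∣ x ∣)) ⟩
  Σ (PB n k) (λ x → PB (m * n) (k ∸ ∣ x ∣))      ↔⟨ PB-+↔ n (m * n) k ⟨
  PB (n + m * n) k                               ∎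
  where open EquationalReasoning

PB[0,k]↔⊤ : ∀ k → PB 0 k ↔ ⊤
PB[0,k]↔⊤ k = mk↔ₛ′ (λ _ → tt) (λ _ → [] , z≤n) (λ _ → refl) (λ { ([] , z≤n) → refl })

PB[1+L,0]↔PB[L,0] : ∀ L → PB (suc L) 0 ↔ PB L 0
PB[1+L,0]↔PB[L,0] L =
  mk↔ₛ′ (λ { (zero ∷ v , v≤0) → v , v≤0 }) (λ (v , v≤0) → zero ∷ v , v≤0)
        (λ _ → refl) (λ { (zero ∷ v , _) → refl })

PB[1+L,1+k]↔PB[L,1+k]⊎PB[1+L,k] : ∀ L k → PB (suc L) (suc k) ↔ (PB L (suc k) ⊎ PB (suc L) k)
PB[1+L,1+k]↔PB[L,1+k]⊎PB[1+L,k] L k = mk↔ₛ′ peel unpeel peel∘unpeel unpeel∘peel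
  where
  peel : PB (suc L) (suc k) → PB L (suc k) ⊎ PB (suc L) k
  peel (zero  ∷ v , v≤1+k)     = inj₁ (v , v≤1+k)
  peel (suc a ∷ v , s≤s a+v≤k) = inj₂ (a ∷ v , a+v≤k)

  unpeel : PB L (suc k) ⊎ PB (suc L) k → PB (suc L) (suc k)
  unpeel (inj₁ (v , v≤1+k))     = zero ∷ v , v≤1+k
  unpeel (inj₂ (a ∷ v , a+v≤k)) = suc a ∷ v , s≤s a+v≤k

  peel∘unpeel : ∀ w → peel (unpeel w) ≡ w
  peel∘unpeel (inj₁ _)           = refl
  peel∘unpeel (inj₂ (_ ∷ _ , _)) = refl

  unpeel∘peel : ∀ v → unpeel (peel v) ≡ v
  unpeel∘peel (zero  ∷ _ , _)     = refl
  unpeel∘peel (suc _ ∷ _ , s≤s _) = refl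

PB↔Fin : ∀ L k → PB L k ↔ Fin ((L + k) C k)
PB↔Fin zero k = begin
  PB 0 k        ↔⟨ PB[0,k]↔⊤ k ⟩
  ⊤             ↔⟨ 1↔⊤ ⟨
  Fin 1         ≡⟨ cong Fin (nCn≡1 k) ⟨
  Fin (k C k)   ∎
  where open EquationalReasoning
PB↔Fin (suc L) zero = begin
  PB (suc L) 0            ↔⟨ PB[1+L,0]↔PB[L,0] L ⟩
  PB L 0                  ↔⟨ PB↔Fin L 0 ⟩
  Fin ((L + 0) C 0)       ≡⟨⟩
  Fin ((suc L + 0) C 0)   ∎
  where open EquationalReasoning
PB↔Fin (suc L) (suc k) = begin
  PB (suc L) (suc k)                                    ↔⟨ PB[1+L,1+k]↔PB[L,1+k]⊎PB[1+L,k] L k ⟩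
  (PB L (suc k) ⊎ PB (suc L) k)                         ↔⟨ PB↔Fin L (suc k) ⊎-↔ PB↔Fin (suc L) k ⟩
  (Fin ((L + suc k) C suc k) ⊎ Fin ((suc L + k) C k))   ↔⟨ +↔⊎ ⟨
  Fin ((L + suc k) C suc k + (suc L + k) C k)           ≡⟨ cong (λ N → Fin ((L + suc k) C suc k + N C k)) (+-suc L k) ⟨
  Fin ((L + suc k) C suc k + (L + suc k) C k)           ≡⟨ cong Fin (+-comm ((L + suc k) C suc k) _) ⟩
  Fin ((L + suc k) C k + (L + suc k) C suc k)           ≡⟨ cong Fin (nCk+nC[k+1]≡[n+1]C[k+1] (L + suc k) k) ⟩
  Fin ((suc L + suc k) C suc k)                         ∎
  where open EquationalReasoning

theorem7p2 : ∀ (n k : ℕ) → 1 ≤ n → ∀ (q : ℕ) → 2 ≤ q →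
    Multichain n k (q ∸ 1) ↔ Fin ((n * (q ∸ 1) + k) C k)
theorem7p2 n k _ q _ = begin
  Multichain n k (q ∸ 1)          ↔⟨ Multichain↔PB (q ∸ 1) n k ⟩
  PB ((q ∸ 1) * n) k              ↔⟨ PB↔Fin ((q ∸ 1) * n) k ⟩
  Fin (((q ∸ 1) * n + k) C k)     ≡⟨ cong (λ N → Fin ((N + k) C k)) (*-comm (q ∸ 1) n) ⟩
  Fin ((n * (q ∸ 1) + k) C k)     ∎
  where open EquationalReasoning
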